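{- Let $D$ be a dcpo which is well-filtered and coherent in its Scott topology. Then for any nonempty $A\subseteq D$, the set $\mathrm{ub}(A)$ of upper bounds of $A$ is compact and saturated in the Scott topology.
   Context: A topological space is coherent if the intersection of any two compact saturated sets is compact; it is well-filtered if whenever a filtered collection $(K_i)_{i\in I}$ of compact saturated sets has intersection contained in an open set $O$, some $K_i$ is contained in $O$. Saturated means equal to the intersection of its open neighbourhoods (for the Scott topology: an upper set). -}

module Defs where

open import Level using (Level; _⊔_; suc)
open import Data.Product using (Σ; ∃; ∃-syntax; _×_; _,_)
open import Data.List using (List)
open import Data.List.Relation.Unary.Any using (Any)
open import Relation.Unary using (Pred; _∈_; _⊆_; _∩_)
open import Relation.Binary.Bundles using (Poset)

module ScottNotions {ℓ : Level} (P : Poset ℓ ℓ ℓ) where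
  open Poset P renaming (Carrier to D)

  Subset : Set (suc ℓ)
  Subset = Pred D ℓ

  Inhabited : Subset → Set ℓ
  Inhabited A = ∃[ a ] (a ∈ A)

  IsUpper : Subset → Set ℓ
  IsUpper A = ∀ {x y} → x ∈ A → x ≤ y → y ∈ A

  ub : Subset → Subset
  ub A x = ∀ {a} → a ∈ A → a ≤ x

  IsLub : Subset → D → Set ℓ
  IsLub A s = s ∈ ub A × (∀ {y} → y ∈ ub A → s ≤ y)

  IsDirected : Subset → Set ℓ
  IsDirected A = Inhabited A
               × (∀ {x y} → x ∈ A → y ∈ A → ∃[ z ] (z ∈ A × x ≤ z × y ≤ z))

  IsDcpo : Set (suc ℓ)
  IsDcpo = ∀ (A : Subset) → IsDirected A → ∃[ s ] IsLub A s

  IsScottOpen : Subset → Set (suc ℓ)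
  IsScottOpen U = IsUpper U
    × (∀ (A : Subset) → IsDirected A → ∀ {s} → IsLub A s → s ∈ U
         → ∃[ a ] (a ∈ A × a ∈ U))

  IsSaturated : Subset → Set ℓ
  IsSaturated = IsUpper

  IsCompact : Subset → Set (suc ℓ)
  IsCompact K = ∀ (I : Set ℓ) (U : I → Subset)
    → (∀ i → IsScottOpen (U i))
    → K ⊆ (λ x → ∃[ i ] (x ∈ U i))
    → ∃[ is ] (K ⊆ (λ x → Any (λ i → x ∈ U i) is))

  IsCompactSaturated : Subset → Set (suc ℓ)
  IsCompactSaturated K = IsCompact K × IsSaturated K

  IsCoherent : Set (suc ℓ)
  IsCoherent = ∀ (K₁ K₂ : Subset) → IsCompactSaturated K₁ → IsCompactSaturated K₂
    → IsCompact (K₁ ∩ K₂)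

  IsFilteredFamily : {I : Set ℓ} → (I → Subset) → Set ℓ
  IsFilteredFamily {I} K = I × (∀ i j → ∃[ k ] (K k ⊆ K i × K k ⊆ K j))

  IsWellFiltered : Set (suc ℓ)
  IsWellFiltered = ∀ (I : Set ℓ) (K : I → Subset)
    → (∀ i → IsCompactSaturated (K i))
    → IsFilteredFamily K
    → (O : Subset) → IsScottOpen O
    → (λ x → ∀ i → x ∈ K i) ⊆ O
    → ∃[ i ] (K i ⊆ O)

-- ub(A) is the intersection of the principal filters ↑a, a ∈ A. Principal
-- filters are compact saturated, so by coherence the finite intersections
-- ↑a₀ ∩ ↑a₁ ∩ … ∩ ↑aₙ are compact saturated too, and they form a filtered
-- family with intersection ub(A). In a well-filtered space the intersection of
-- such a family is compact: if it is covered by opens, the union of the cover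
-- is open, so a single member of the family is covered, and compactness of
-- that member yields a finite subcover.
module Submission where

open import Defs
open import Level using (Level)
open import Relation.Binary.Bundles using (Poset)
open import Data.Product using (Σ; _,_; proj₁; proj₂)
open import Data.List using (List; []; _∷_; _++_)
open import Data.List.Relation.Unary.Any using (here)
open import Relation.Unary using (_∈_; _⊆_; _∩_; _≐_; ⋂; ⋃)

module _ {ℓ : Level} (P : Poset ℓ ℓ ℓ) where
  open Poset P renaming (Carrier to D)
  open ScottNotions P

  ↑_ : D → Subset
  ↑ a = a ≤_

  ↑-isCompactSaturated : ∀ a → IsCompactSaturated (↑ a)
  ↑-isCompactSaturated a = isCompact , trans
    where
    isCompact : IsCompact (↑ a)
    isCompact I U U-open cover with cover refl
    ... | i , a∈Uᵢ = i ∷ [] , λ a≤x → here (proj₁ (U-open i) a∈Uᵢ a≤x)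

  ⋃-isScottOpen : ∀ {I : Set ℓ} (U : I → Subset) →
                  (∀ i → IsScottOpen (U i)) → IsScottOpen (⋃ I U)
  ⋃-isScottOpen U U-open =
      (λ { (i , x∈Uᵢ) x≤y → i , proj₁ (U-open i) x∈Uᵢ x≤y })
    , λ { B B-directed s-lub (i , s∈Uᵢ) →
            let b , b∈B , b∈Uᵢ = proj₂ (U-open i) B B-directed s-lub s∈Uᵢ
            in  b , b∈B , i , b∈Uᵢ }

  isCompact-resp-≐ : ∀ {K L} → K ≐ L → IsCompact K → IsCompact L
  isCompact-resp-≐ (K⊆L , L⊆K) K-compact I U U-open cover
    with K-compact I U U-open (λ x∈K → cover (K⊆L x∈K))
  ... | is , subcover = is , λ x∈L → subcover (L⊆K x∈L)

  ⋂-isCompact : IsWellFiltered → ∀ {I : Set ℓ} (K : I → Subset) →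
                (∀ i → IsCompactSaturated (K i)) → IsFilteredFamily K →
                IsCompact (⋂ I K)
  ⋂-isCompact wf K K-cs K-filtered J U U-open cover
    with wf _ K K-cs K-filtered (⋃ J U) (⋃-isScottOpen U U-open) cover
  ... | i , Kᵢ⊆⋃U with proj₁ (K-cs i) J U U-open Kᵢ⊆⋃U
  ...   | js , subcover = js , λ x∈⋂K → subcover (x∈⋂K i)

  -- The base K₀ makes the empty list a valid index whose set is compact
  -- without assuming a top element.
  module FiniteIntersections {J : Set ℓ} (K₀ : Subset) (F : J → Subset) where

    ⋂ᶠ : List J → Subset
    ⋂ᶠ []       = K₀
    ⋂ᶠ (j ∷ js) = F j ∩ ⋂ᶠ js

    ⋂ᶠ-isCompactSaturated : IsCoherent → IsCompactSaturated K₀ →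
                            (∀ j → IsCompactSaturated (F j)) →
                            ∀ js → IsCompactSaturated (⋂ᶠ js)
    ⋂ᶠ-isCompactSaturated coh K₀-cs F-cs []       = K₀-cs
    ⋂ᶠ-isCompactSaturated coh K₀-cs F-cs (j ∷ js) =
        coh (F j) (⋂ᶠ js) (F-cs j) ⋂ᶠjs-cs
      , λ { (x∈Fⱼ , x∈⋂ᶠjs) x≤y → proj₂ (F-cs j) x∈Fⱼ x≤y , proj₂ ⋂ᶠjs-cs x∈⋂ᶠjs x≤y }
      where
      ⋂ᶠjs-cs : IsCompactSaturated (⋂ᶠ js)
      ⋂ᶠjs-cs = ⋂ᶠ-isCompactSaturated coh K₀-cs F-cs js

    ⋂ᶠ-++ˡ : ∀ js ks → ⋂ᶠ (js ++ ks) ⊆ ⋂ᶠ js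
    ⋂ᶠ-++ˡ []       []       x∈K₀          = x∈K₀
    ⋂ᶠ-++ˡ []       (k ∷ ks) (_ , x∈⋂ᶠks)  = ⋂ᶠ-++ˡ [] ks x∈⋂ᶠks
    ⋂ᶠ-++ˡ (j ∷ js) ks       (x∈Fⱼ , x∈⋂ᶠ) = x∈Fⱼ , ⋂ᶠ-++ˡ js ks x∈⋂ᶠ

    ⋂ᶠ-++ʳ : ∀ js ks → ⋂ᶠ (js ++ ks) ⊆ ⋂ᶠ ks
    ⋂ᶠ-++ʳ []       ks x∈⋂ᶠ       = x∈⋂ᶠ
    ⋂ᶠ-++ʳ (j ∷ js) ks (_ , x∈⋂ᶠ) = ⋂ᶠ-++ʳ js ks x∈⋂ᶠ

    ⋂ᶠ-isFilteredFamily : IsFilteredFamily ⋂ᶠ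
    ⋂ᶠ-isFilteredFamily = [] , λ js ks → js ++ ks , ⋂ᶠ-++ˡ js ks , ⋂ᶠ-++ʳ js ks

  module _ (A : Subset) (a₀ : D) (a₀∈A : a₀ ∈ A) where
    open FiniteIntersections {Σ D (_∈ A)} (↑ a₀) (λ a → ↑ proj₁ a)

    ⋂⋂ᶠ≐ub : ⋂ _ ⋂ᶠ ≐ ub A
    ⋂⋂ᶠ≐ub = (λ x∈⋂ a∈A → proj₁ (x∈⋂ ((_ , a∈A) ∷ []))) , ub⊆⋂ᶠ
      where
      ub⊆⋂ᶠ : ∀ {x} → x ∈ ub A → ∀ as → x ∈ ⋂ᶠ as
      ub⊆⋂ᶠ x∈ub []               = x∈ub a₀∈A
      ub⊆⋂ᶠ x∈ub ((a , a∈A) ∷ as) = x∈ub a∈A , ub⊆⋂ᶠ x∈ub as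

    ub-isCompact : IsWellFiltered → IsCoherent → IsCompact (ub A)
    ub-isCompact wf coh = isCompact-resp-≐ ⋂⋂ᶠ≐ub
      (⋂-isCompact wf ⋂ᶠ
        (⋂ᶠ-isCompactSaturated coh (↑-isCompactSaturated a₀)
                                   (λ a → ↑-isCompactSaturated (proj₁ a)))
        ⋂ᶠ-isFilteredFamily)

  ub-isUpper : ∀ A → IsUpper (ub A)
  ub-isUpper A x∈ub x≤y a∈A = trans (x∈ub a∈A) x≤y

lemma2p16 : {ℓ : Level} (P : Poset ℓ ℓ ℓ) → let open ScottNotions P in
    IsDcpo → IsWellFiltered → IsCoherent →
    (A : Subset) → Inhabited A → IsCompactSaturated (ub A)
lemma2p16 P _ wf coh A (a₀ , a₀∈A) =
  ub-isCompact P A a₀ a₀∈A wf coh , ub-isUpper P A
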